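{- For involutions $\gamma,\tau\in S_n$, $\gamma\le\tau$ in the Bruhat order of $S_n$ if and only if (1) $\gamma(i;\cdot)\geq\tau(i;\cdot)$ for $i=1,\dots,n$, and (2) $\gamma(s;t)\le\tau(s;t)$ for all $1\le s<t\le n$.
   Context: An involution $\gamma\in S_n$ is encoded as a string $\gamma_1\cdots\gamma_n$ where $\gamma_i$ is a dot if $\gamma(i)=i$, and $\gamma_i=\gamma_j\in\mathbb{N}$ whenever $\gamma$ swaps $i$ and $j$ (distinct numbers for distinct pairs). Define $\gamma(i;\cdot)$ as the number of dots plus twice the number of pairs of equal natural numbers with both entries among $\gamma_1\cdots\gamma_i$, and for $s<t$, $\gamma(s;t)=\#\{\text{pairs }\gamma_a=\gamma_b\in\mathbb{N}: a\le s,\ b>t\}$. The Bruhat order on involutions is the restriction of the Bruhat order of $S_n$. -}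

module Defs where

open import Data.Nat using (ℕ; suc; _+_; _*_; _<_; _≤_; _≥_)
import Data.Nat.Properties as ℕP
open import Data.Fin using (Fin; toℕ)
import Data.Fin.Properties as FinP
open import Data.Fin.Permutation using (Permutation; _⟨$⟩ʳ_)
import Data.Fin.Permutation.Components as PC
open import Data.List using (List; length; filter; cartesianProduct)
open import Level using (0ℓ)
open import Data.Product using (_×_; _,_; proj₁; proj₂; Σ)
open import Relation.Binary.PropositionalEquality using (_≡_; _≢_)
open import Relation.Nullary using (Dec; _×-dec_)
open import Relation.Unary using (Pred; Decidable)

allFin : ∀ n → List (Fin n)
allFin n = Data.List.allFin n

countFin : ∀ {n} {P : Pred (Fin n) 0ℓ} → Decidable P → ℕ
countFin {n} P? = length (filter P? (allFin n))

countPairs : ∀ {n} {P : Pred (Fin n × Fin n) 0ℓ} → Decidable P → ℕ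
countPairs {n} P? = length (filter P? (cartesianProduct (allFin n) (allFin n)))

-- S_n : permutations of Fin n (positions 1..n correspond to 0..n-1)
Perm : ℕ → Set
Perm n = Permutation n n

_≈ₚ_ : ∀ {n} → Perm n → Perm n → Set
π ≈ₚ σ = ∀ k → π ⟨$⟩ʳ k ≡ σ ⟨$⟩ʳ k

IsInvolution : ∀ {n} → Perm n → Set
IsInvolution γ = ∀ k → γ ⟨$⟩ʳ (γ ⟨$⟩ʳ k) ≡ k

inversions : ∀ {n} → Perm n → ℕ
inversions π = countPairs (λ p → (proj₁ p FinP.<? proj₂ p)
                           ×-dec (π ⟨$⟩ʳ proj₂ p FinP.<? π ⟨$⟩ʳ proj₁ p))

BruhatStep : ∀ {n} → Perm n → Perm n → Set
BruhatStep {n} u v =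
  Σ (Fin n) λ i → Σ (Fin n) λ j → i ≢ j ×
    ((∀ k → v ⟨$⟩ʳ k ≡ u ⟨$⟩ʳ (PC.transpose i j k)) × inversions u < inversions v)

data _≤B_ {n} : Perm n → Perm n → Set where
  ≤B-refl : ∀ {u w} → u ≈ₚ w → u ≤B w
  ≤B-step : ∀ {u v w} → BruhatStep u v → v ≤B w → u ≤B w

-- γ(i;·) : number of fixed points a ≤ i plus twice the number of
-- 2-cycles {a,b} with a < b ≤ i   (1-indexed i; position a has toℕ a + 1)
dotCount : ∀ {n} → Perm n → ℕ → ℕ
dotCount γ i =
  countFin (λ a → (toℕ a ℕP.<? i) ×-dec (γ ⟨$⟩ʳ a FinP.≟ a))
  + 2 * countPairs (λ p → (proj₁ p FinP.<? proj₂ p)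
                     ×-dec ((toℕ (proj₂ p) ℕP.<? i)
                     ×-dec (γ ⟨$⟩ʳ proj₁ p FinP.≟ proj₂ p)))

-- γ(s;t) : number of 2-cycles {a,b} with a ≤ s and b > t (1-indexed)
pairCount : ∀ {n} → Perm n → ℕ → ℕ → ℕ
pairCount γ s t =
  countPairs (λ p → (proj₁ p FinP.<? proj₂ p)
               ×-dec ((toℕ (proj₁ p) ℕP.<? s)
               ×-dec ((t ℕP.<? suc (toℕ (proj₂ p)))
               ×-dec (γ ⟨$⟩ʳ proj₁ p FinP.≟ proj₂ p))))

-- By the tableau criterion, u ≤ w in the Bruhat order of S_n iff rank u p q ≤ rank w p q
-- for all p, q, where rank π p q = #{a < p ∣ π a ≥ q}. A Bruhat step swaps an ascent and can
-- only raise ranks. Conversely, if u ≠ w lies below w in all ranks, let i be the first position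
-- where they differ: then u i < w i, and swapping i with the first j > i such that
-- u i < u j ≤ w i is a Bruhat step that keeps all ranks below those of w while raising the
-- total rank, so iterating reaches w.
--
-- For an involution γ, γ(i;·) + rank γ i i = i, since γ(i;·) counts the points of γ in the
-- square [0 , i)²; γ(s;t) = rank γ s t for s < t; and the symmetry of γ gives
-- rank γ p q + q = p + rank γ q p, so the ranks below the diagonal are determined by those
-- above it. Hence (1) and (2) say exactly that the ranks of γ are dominated by those of τ.
module Submission where

open import Defs
open import Data.Nat as ℕ
  using (ℕ; zero; suc; _+_; _*_; _⊓_; _≤_; _<_; _≥_; z≤n; s≤s)
open import Data.Nat.Properties
open import Data.Fin as F using (Fin; toℕ; punchIn)
import Data.Fin.Properties as FinP
open import Data.Fin.Permutation using (Permutation; _⟨$⟩ʳ_; _⟨$⟩ˡ_; inverseˡ; inverseʳ; _∘ₚ_)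
import Data.Fin.Permutation as Pm
import Data.Fin.Permutation.Components as PC
open import Data.List using (List; length; filter; cartesianProduct; tabulate; map; _++_)
import Data.List.Properties as ListP
import Algebra.Properties.CommutativeMonoid.Sum as CommutativeMonoidSum
open import Data.Product using (_×_; _,_; proj₁; proj₂; Σ; swap)
open import Data.Empty using (⊥-elim)
open import Data.Sum using (_⊎_; inj₁; inj₂; [_,_]′)
import Data.Sum
open import Function using (_∘_; _⇔_; mk⇔)
open import Relation.Binary using (tri<; tri≈; tri>)
open import Level using (0ℓ)
open import Relation.Binary.PropositionalEquality
open import Relation.Nullary using (Dec; yes; no; ¬_; _×-dec_; ¬?)
open import Relation.Nullary.Decidable using (decidable-stable)
open import Relation.Unary using (Pred; Decidable)
open import Data.Nat.Tactic.RingSolver using (solve-∀)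

open CommutativeMonoidSum +-0-commutativeMonoid
  using (sum; sum-cong-≗; ∑-distrib-+; sum-permute; sum-remove)

-- Indicators and finite sums

𝟙 : ∀ {P : Set} → Dec P → ℕ
𝟙 (yes _) = 1
𝟙 (no _)  = 0

𝟙-yes : ∀ {P : Set} (d : Dec P) → P → 𝟙 d ≡ 1
𝟙-yes (yes _) _ = refl
𝟙-yes (no ¬p) p = ⊥-elim (¬p p)

𝟙-no : ∀ {P : Set} (d : Dec P) → ¬ P → 𝟙 d ≡ 0
𝟙-no (yes p) ¬p = ⊥-elim (¬p p)
𝟙-no (no _)  _  = refl

𝟙-mono : ∀ {P Q : Set} (d : Dec P) (e : Dec Q) → (P → Q) → 𝟙 d ≤ 𝟙 e
𝟙-mono (yes p) e       f = ≤-reflexive (sym (𝟙-yes e (f p)))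
𝟙-mono (no _)  _       _ = z≤n

𝟙-cong : ∀ {P Q : Set} (d : Dec P) (e : Dec Q) → (P → Q) → (Q → P) → 𝟙 d ≡ 𝟙 e
𝟙-cong d e f g = ≤-antisym (𝟙-mono d e f) (𝟙-mono e d g)

𝟙-split : ∀ {P Q : Set} (d : Dec P) (e : Dec Q) → 𝟙 d ≡ 𝟙 (d ×-dec e) + 𝟙 (d ×-dec ¬? e)
𝟙-split (yes _) (yes _) = refl
𝟙-split (yes _) (no _)  = refl
𝟙-split (no _)  _       = refl

𝟙-exchange : ∀ {P₁ P₂ Q₁ Q₂ : Set} (d₁ : Dec P₁) (d₂ : Dec P₂) (e₁ : Dec Q₁) (e₂ : Dec Q₂) →
  (P₂ → P₁) → (Q₁ → Q₂) →
  𝟙 (d₁ ×-dec e₂) + 𝟙 (d₂ ×-dec e₁)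
    ≡ 𝟙 (d₁ ×-dec e₁) + 𝟙 (d₂ ×-dec e₂) + 𝟙 (d₁ ×-dec ¬? d₂ ×-dec ¬? e₁ ×-dec e₂)
𝟙-exchange (no ¬p₁) (yes p₂) _ _ P₂⇒P₁ _ = ⊥-elim (¬p₁ (P₂⇒P₁ p₂))
𝟙-exchange _ _ (yes q₁) (no ¬q₂) _ Q₁⇒Q₂ = ⊥-elim (¬q₂ (Q₁⇒Q₂ q₁))
𝟙-exchange (yes _) (yes _) (yes _) (yes _) _ _ = refl
𝟙-exchange (yes _) (yes _) (no _)  (yes _) _ _ = refl
𝟙-exchange (yes _) (yes _) (no _)  (no _)  _ _ = refl
𝟙-exchange (yes _) (no _)  (yes _) (yes _) _ _ = refl
𝟙-exchange (yes _) (no _)  (no _)  (yes _) _ _ = refl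
𝟙-exchange (yes _) (no _)  (no _)  (no _)  _ _ = refl
𝟙-exchange (no _)  (no _)  _       _       _ _ = refl

𝟙-exchange-≤ : ∀ {P₁ P₂ Q₁ Q₂ : Set} (d₁ : Dec P₁) (d₂ : Dec P₂) (e₁ : Dec Q₁) (e₂ : Dec Q₂) →
  (P₂ → P₁) → (Q₁ → Q₂) → 𝟙 (d₁ ×-dec e₁) + 𝟙 (d₂ ×-dec e₂) ≤ 𝟙 (d₁ ×-dec e₂) + 𝟙 (d₂ ×-dec e₁)
𝟙-exchange-≤ d₁ d₂ e₁ e₂ P₂⇒P₁ Q₁⇒Q₂ =
  ≤-trans (m≤m+n _ _) (≤-reflexive (sym (𝟙-exchange d₁ d₂ e₁ e₂ P₂⇒P₁ Q₁⇒Q₂)))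

𝟙-trichotomy : ∀ {n} (a b : Fin n) i →
  𝟙 ((toℕ a ℕ.<? i) ×-dec (toℕ b ℕ.<? i))
    ≡ 𝟙 ((toℕ a ℕ.<? i) ×-dec (b FinP.≟ a)) + 𝟙 ((toℕ a ℕ.<? toℕ b) ×-dec (toℕ b ℕ.<? i))
      + 𝟙 ((toℕ b ℕ.<? toℕ a) ×-dec (toℕ a ℕ.<? i))
𝟙-trichotomy a b i with FinP.<-cmp a b
... | tri< a<b _ _
  rewrite 𝟙-no ((toℕ a ℕ.<? i) ×-dec (b FinP.≟ a)) (λ (_ , b≡a) → <-irrefl (cong toℕ (sym b≡a)) a<b)
        | 𝟙-no ((toℕ b ℕ.<? toℕ a) ×-dec (toℕ a ℕ.<? i)) (λ (b<a , _) → <-asym a<b b<a)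
        = trans (𝟙-cong ((toℕ a ℕ.<? i) ×-dec (toℕ b ℕ.<? i)) ((toℕ a ℕ.<? toℕ b) ×-dec (toℕ b ℕ.<? i))
                        (λ (_ , b<i) → a<b , b<i) (λ (_ , b<i) → <-trans a<b b<i , b<i))
                (sym (+-identityʳ _))
... | tri≈ _ refl _
  rewrite 𝟙-no ((toℕ a ℕ.<? toℕ a) ×-dec (toℕ a ℕ.<? i)) (λ (a<a , _) → <-irrefl refl a<a)
        = trans (𝟙-cong ((toℕ a ℕ.<? i) ×-dec (toℕ a ℕ.<? i)) ((toℕ a ℕ.<? i) ×-dec (a FinP.≟ a))
                        (λ (a<i , _) → a<i , refl) (λ (a<i , _) → a<i , a<i))
                (sym (trans (+-identityʳ _) (+-identityʳ _)))
... | tri> _ _ b<a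
  rewrite 𝟙-no ((toℕ a ℕ.<? i) ×-dec (b FinP.≟ a)) (λ (_ , b≡a) → <-irrefl (cong toℕ b≡a) b<a)
        | 𝟙-no ((toℕ a ℕ.<? toℕ b) ×-dec (toℕ b ℕ.<? i)) (λ (a<b , _) → <-asym a<b b<a)
        = 𝟙-cong ((toℕ a ℕ.<? i) ×-dec (toℕ b ℕ.<? i)) ((toℕ b ℕ.<? toℕ a) ×-dec (toℕ a ℕ.<? i))
                 (λ (a<i , _) → b<a , a<i) (λ (_ , a<i) → a<i , <-trans b<a a<i)

sum-zero : ∀ {n} {f : Fin n → ℕ} → (∀ x → f x ≡ 0) → sum f ≡ 0
sum-zero {zero}  _    = refl
sum-zero {suc n} f≗0 = cong₂ _+_ (f≗0 F.zero) (sum-zero (f≗0 ∘ F.suc))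

sum-mono : ∀ {n} {f g : Fin n → ℕ} → (∀ x → f x ≤ g x) → sum f ≤ sum g
sum-mono {zero}  _   = z≤n
sum-mono {suc n} f≤g = +-mono-≤ (f≤g F.zero) (sum-mono (f≤g ∘ F.suc))

sum-single : ∀ {n} (c : Fin n) {f : Fin n → ℕ} → (∀ x → x ≢ c → f x ≡ 0) → sum f ≡ f c
sum-single {suc n} c {f} f≗0 = begin
  sum f                          ≡⟨ sum-remove f ⟩
  f c + sum (f ∘ punchIn c)      ≡⟨ cong (f c +_) (sum-zero (λ x → f≗0 _ (FinP.punchInᵢ≢i c x))) ⟩
  f c + 0                        ≡⟨ +-identityʳ (f c) ⟩
  f c                            ∎
  where open ≡-Reasoning

sum-remove-+ : ∀ {n} (c : Fin (suc n)) (f : Fin (suc n) → ℕ) (k : ℕ) →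
  sum f + k ≡ f c + k + sum (f ∘ punchIn c)
sum-remove-+ c f k = begin
  sum f + k                          ≡⟨ cong (_+ k) (sum-remove f) ⟩
  f c + sum (f ∘ punchIn c) + k      ≡⟨ +-assoc (f c) _ k ⟩
  f c + (sum (f ∘ punchIn c) + k)    ≡⟨ cong (f c +_) (+-comm _ k) ⟩
  f c + (k + sum (f ∘ punchIn c))    ≡⟨ +-assoc (f c) k _ ⟨
  f c + k + sum (f ∘ punchIn c)      ∎
  where open ≡-Reasoning

sum-≤-except₁ : ∀ {n} (c : Fin n) {f g : Fin n → ℕ} {k l : ℕ} →
  f c + k ≤ g c + l → (∀ x → x ≢ c → f x ≤ g x) → sum f + k ≤ sum g + l
sum-≤-except₁ {suc n} c {f} {g} {k} {l} at-c elsewhere = begin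
  sum f + k                          ≡⟨ sum-remove-+ c f k ⟩
  f c + k + sum (f ∘ punchIn c)      ≤⟨ +-mono-≤ at-c (sum-mono (λ x → elsewhere _ (FinP.punchInᵢ≢i c x))) ⟩
  g c + l + sum (g ∘ punchIn c)      ≡⟨ sum-remove-+ c g l ⟨
  sum g + l                          ∎
  where open ≤-Reasoning

sum-≤-except₂ : ∀ {n} {c d : Fin n} {f g : Fin n → ℕ} {k l : ℕ} → c ≢ d →
  f c + f d + k ≤ g c + g d + l → (∀ x → x ≢ c → x ≢ d → f x ≤ g x) → sum f + k ≤ sum g + l
sum-≤-except₂ {suc n} {c} {d} {f} {g} {k} {l} c≢d at-cd elsewhere = begin
  sum f + k                                  ≡⟨ sum-remove-+ c f k ⟩
  f c + k + sum (f ∘ punchIn c)              ≡⟨ +-comm (f c + k) _ ⟩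
  sum (f ∘ punchIn c) + (f c + k)            ≤⟨ sum-≤-except₁ d′ at-d′ elsewhere′ ⟩
  sum (g ∘ punchIn c) + (g c + l)            ≡⟨ +-comm _ (g c + l) ⟩
  g c + l + sum (g ∘ punchIn c)              ≡⟨ sum-remove-+ c g l ⟨
  sum g + l                                  ∎
  where
  open ≤-Reasoning
  d′ : Fin n
  d′ = F.punchOut c≢d
  d′↦d : punchIn c d′ ≡ d
  d′↦d = FinP.punchIn-punchOut c≢d
  at-d′ : f (punchIn c d′) + (f c + k) ≤ g (punchIn c d′) + (g c + l)
  at-d′ = subst (λ z → f z + (f c + k) ≤ g z + (g c + l)) (sym d′↦d)
    (subst₂ _≤_ (swap-first (f c) (f d) k) (swap-first (g c) (g d) l) at-cd)
    where
    swap-first : ∀ a b m → a + b + m ≡ b + (a + m)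
    swap-first = solve-∀
  elsewhere′ : ∀ x → x ≢ d′ → f (punchIn c x) ≤ g (punchIn c x)
  elsewhere′ x x≢d′ = elsewhere _ (FinP.punchInᵢ≢i c x)
    (λ eq → x≢d′ (FinP.punchIn-injective c x d′ (trans eq (sym d′↦d))))

sum-≡-except₂ : ∀ {n} {c d : Fin n} {f g : Fin n → ℕ} {k l : ℕ} → c ≢ d →
  f c + f d + k ≡ g c + g d + l → (∀ x → x ≢ c → x ≢ d → f x ≡ g x) → sum f + k ≡ sum g + l
sum-≡-except₂ c≢d at-cd elsewhere = ≤-antisym
  (sum-≤-except₂ c≢d (≤-reflexive at-cd) (λ x x≢c x≢d → ≤-reflexive (elsewhere x x≢c x≢d)))
  (sum-≤-except₂ c≢d (≤-reflexive (sym at-cd)) (λ x x≢c x≢d → ≤-reflexive (sym (elsewhere x x≢c x≢d))))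

sum-< : ∀ {n} (c : Fin n) {f g : Fin n → ℕ} → (∀ x → f x ≤ g x) → f c < g c → sum f < sum g
sum-< c {f} {g} f≤g fc<gc = subst₂ _≤_ (+-comm _ 1) (+-identityʳ _)
  (sum-≤-except₁ c (subst₂ _≤_ (+-comm 1 _) (sym (+-identityʳ _)) fc<gc) (λ x _ → f≤g x))

count-< : ∀ n i → sum {n} (λ a → 𝟙 (toℕ a ℕ.<? i)) ≡ i ⊓ n
count-< zero    i       = sym (⊓-zeroʳ i)
count-< (suc n) zero    = count-< n zero
count-< (suc n) (suc i) = cong suc (trans
  (sum-cong-≗ {n} {λ a → 𝟙 (suc (toℕ a) ℕ.<? suc i)} (λ a → 𝟙-cong (suc (toℕ a) ℕ.<? suc i) (toℕ a ℕ.<? i) ℕ.s<s⁻¹ ℕ.s<s))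
  (count-< n i))

length-filter-tabulate : ∀ {A : Set} {n} {P : Pred A 0ℓ} (P? : Decidable P) (f : Fin n → A) →
  length (filter P? (tabulate f)) ≡ sum (λ a → 𝟙 (P? (f a)))
length-filter-tabulate {n = zero}  P? f = refl
length-filter-tabulate {n = suc n} P? f with P? (f F.zero)
... | yes _ = cong suc (length-filter-tabulate P? (f ∘ F.suc))
... | no _  = length-filter-tabulate P? (f ∘ F.suc)

countFin≡sum : ∀ {n} {P : Pred (Fin n) 0ℓ} (P? : Decidable P) → countFin P? ≡ sum (λ a → 𝟙 (P? a))
countFin≡sum P? = length-filter-tabulate P? (λ a → a)

countPairs≡sum : ∀ {n} {P : Pred (Fin n × Fin n) 0ℓ} (P? : Decidable P) →
  countPairs P? ≡ sum (λ a → sum (λ b → 𝟙 (P? (a , b))))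
countPairs≡sum {n} P? = rows (λ a → a)
  where
  rows : ∀ {m} (f : Fin m → Fin n) →
    length (filter P? (cartesianProduct (tabulate f) (tabulate (λ b → b))))
      ≡ sum (λ a → sum (λ b → 𝟙 (P? (f a , b))))
  rows {zero}  f = refl
  rows {suc m} f = begin
    length (filter P? (map (f F.zero ,_) bs ++ cartesianProduct (tabulate (f ∘ F.suc)) bs))
      ≡⟨ cong length (ListP.filter-++ P? (map (f F.zero ,_) bs) _) ⟩
    length (filter P? (map (f F.zero ,_) bs) ++ filter P? (cartesianProduct (tabulate (f ∘ F.suc)) bs))
      ≡⟨ ListP.length-++ (filter P? (map (f F.zero ,_) bs)) ⟩
    length (filter P? (map (f F.zero ,_) bs)) + _
      ≡⟨ cong₂ _+_ first-row (rows (f ∘ F.suc)) ⟩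
    _ ∎
    where
    open ≡-Reasoning
    bs : List (Fin n)
    bs = tabulate (λ b → b)
    first-row : length (filter P? (map (f F.zero ,_) bs)) ≡ sum (λ b → 𝟙 (P? (f F.zero , b)))
    first-row = trans (cong (length ∘ filter P?) (ListP.map-tabulate (λ b → b) (f F.zero ,_)))
                      (length-filter-tabulate P? (f F.zero ,_))

countPairs-graph : ∀ {n} (π : Perm n) {R : Pred (Fin n × Fin n) 0ℓ} (R? : Decidable R) →
  (∀ {a b} → R (a , b) → π ⟨$⟩ʳ a ≡ b) → countPairs R? ≡ sum (λ a → 𝟙 (R? (a , π ⟨$⟩ʳ a)))
countPairs-graph π R? graph = trans (countPairs≡sum R?) (sum-cong-≗ λ a →
  sum-single (π ⟨$⟩ʳ a) (λ b b≢πa → 𝟙-no (R? (a , b)) (λ Rab → b≢πa (sym (graph Rab)))))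

Perm-injective : ∀ {n} (π : Perm n) {a b} → π ⟨$⟩ʳ a ≡ π ⟨$⟩ʳ b → a ≡ b
Perm-injective π {a} {b} πa≡πb = trans (sym (inverseˡ π)) (trans (cong (π ⟨$⟩ˡ_) πa≡πb) (inverseˡ π))

Fin-≤⇒<⊎≡ : ∀ {n} {a b : Fin n} → a F.≤ b → a F.< b ⊎ a ≡ b
Fin-≤⇒<⊎≡ a≤b = Data.Sum.map₂ FinP.toℕ-injective (m≤n⇒m<n∨m≡n a≤b)

least-counterexample : ∀ {n} {P : Pred (Fin n) 0ℓ} → Decidable P → ¬ (∀ a → P a) →
  Σ (Fin n) λ i → ¬ P i × (∀ a → a F.< i → P a)
least-counterexample {n} {P} P? ¬∀P with FinP.¬∀⟶∃¬-smallest n P P? ¬∀P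
... | i , ¬Pi , below = i , ¬Pi , λ a a<i → subst P (inject≡a a a<i) (below (F.fromℕ< a<i))
  where
  inject≡a : ∀ a (a<i : a F.< i) → F.inject (F.fromℕ< a<i) ≡ a
  inject≡a a a<i = FinP.toℕ-injective (trans (FinP.toℕ-inject (F.fromℕ< a<i)) (FinP.toℕ-fromℕ< a<i))

least-witness : ∀ {n} {P : Pred (Fin n) 0ℓ} → Decidable P → ∀ {j} → P j →
  Σ (Fin n) λ i → P i × (∀ a → a F.< i → ¬ P a)
least-witness P? {j} Pj with least-counterexample (¬? ∘ P?) (λ ∀¬P → ∀¬P j Pj)
... | i , ¬¬Pi , below = i , decidable-stable (P? i) ¬¬Pi , below

first-difference : ∀ {n} (u w : Perm n) →
  u ≈ₚ w ⊎ Σ (Fin n) λ i → u ⟨$⟩ʳ i ≢ w ⟨$⟩ʳ i × (∀ a → a F.< i → u ⟨$⟩ʳ a ≡ w ⟨$⟩ʳ a)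
first-difference u w with FinP.all? (λ a → u ⟨$⟩ʳ a FinP.≟ w ⟨$⟩ʳ a)
... | yes u≈w = inj₁ u≈w
... | no u≉w  = inj₂ (least-counterexample (λ a → u ⟨$⟩ʳ a FinP.≟ w ⟨$⟩ʳ a) u≉w)

-- Rank matrices

rankEntry : ∀ {n} → Perm n → ℕ → ℕ → Fin n → ℕ
rankEntry π p q a = 𝟙 ((toℕ a ℕ.<? p) ×-dec (q ℕ.≤? toℕ (π ⟨$⟩ʳ a)))

rank : ∀ {n} → Perm n → ℕ → ℕ → ℕ
rank π p q = sum (rankEntry π p q)

module _ {n} (π : Perm n) (p q : ℕ) (a : Fin n) where

  rankEntry-yes : toℕ a < p → q ≤ toℕ (π ⟨$⟩ʳ a) → rankEntry π p q a ≡ 1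
  rankEntry-yes a<p q≤πa = 𝟙-yes ((toℕ a ℕ.<? p) ×-dec (q ℕ.≤? toℕ (π ⟨$⟩ʳ a))) (a<p , q≤πa)

  rankEntry-no : (toℕ a < p → ¬ q ≤ toℕ (π ⟨$⟩ʳ a)) → rankEntry π p q a ≡ 0
  rankEntry-no ¬entry = 𝟙-no ((toℕ a ℕ.<? p) ×-dec (q ℕ.≤? toℕ (π ⟨$⟩ʳ a))) (λ (a<p , q≤πa) → ¬entry a<p q≤πa)

  rankEntry-mono : ∀ (σ : Perm n) q′ → (toℕ a < p → q ≤ toℕ (π ⟨$⟩ʳ a) → q′ ≤ toℕ (σ ⟨$⟩ʳ a)) →
    rankEntry π p q a ≤ rankEntry σ p q′ a
  rankEntry-mono σ q′ entry = 𝟙-mono ((toℕ a ℕ.<? p) ×-dec (q ℕ.≤? toℕ (π ⟨$⟩ʳ a)))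
    ((toℕ a ℕ.<? p) ×-dec (q′ ℕ.≤? toℕ (σ ⟨$⟩ʳ a))) (λ (a<p , q≤πa) → a<p , entry a<p q≤πa)

rankEntry-cong : ∀ {n} (π σ : Perm n) p q {a b} → π ⟨$⟩ʳ a ≡ σ ⟨$⟩ʳ b →
  rankEntry π p q a ≡ 𝟙 ((toℕ a ℕ.<? p) ×-dec (q ℕ.≤? toℕ (σ ⟨$⟩ʳ b)))
rankEntry-cong π σ p q {a} πa≡σb = cong (λ z → 𝟙 ((toℕ a ℕ.<? p) ×-dec (q ℕ.≤? toℕ z))) πa≡σb

infix 4 _≤ʳ_
_≤ʳ_ : ∀ {n} → Perm n → Perm n → Set
u ≤ʳ w = ∀ p q → rank u p q ≤ rank w p q

rank-cong : ∀ {n} {π σ : Perm n} → π ≈ₚ σ → ∀ p q → rank π p q ≡ rank σ p q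
rank-cong {π = π} {σ} π≈σ p q = sum-cong-≗ (λ a → rankEntry-cong π σ p q (π≈σ a))

rank-zeroˡ : ∀ {n} (π : Perm n) q → rank π 0 q ≡ 0
rank-zeroˡ π q = sum-zero (λ a → 𝟙-no ((toℕ a ℕ.<? 0) ×-dec (q ℕ.≤? toℕ (π ⟨$⟩ʳ a))) (λ ()))

rank-≥ : ∀ {n} (π : Perm n) p {q} → n ≤ q → rank π p q ≡ 0
rank-≥ π p {q} n≤q = sum-zero (λ a → 𝟙-no ((toℕ a ℕ.<? p) ×-dec (q ℕ.≤? toℕ (π ⟨$⟩ʳ a)))
  (λ (_ , q≤πa) → <⇒≱ (FinP.toℕ<n (π ⟨$⟩ʳ a)) (≤-trans n≤q q≤πa)))

lowerRankEntry : ∀ {n} → Perm n → ℕ → ℕ → Fin n → ℕ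
lowerRankEntry π p q a = 𝟙 ((toℕ a ℕ.<? p) ×-dec (toℕ (π ⟨$⟩ʳ a) ℕ.<? q))

lowerRank : ∀ {n} → Perm n → ℕ → ℕ → ℕ
lowerRank π p q = sum (lowerRankEntry π p q)

lowerRank+rank : ∀ {n} (π : Perm n) p q → lowerRank π p q + rank π p q ≡ p ⊓ n
lowerRank+rank {n} π p q = begin
  lowerRank π p q + rank π p q                                  ≡⟨ ∑-distrib-+ (lowerRankEntry π p q) (rankEntry π p q) ⟨
  sum (λ a → lowerRankEntry π p q a + rankEntry π p q a)       ≡⟨ sum-cong-≗ split ⟨
  sum (λ (a : Fin n) → 𝟙 (toℕ a ℕ.<? p))                       ≡⟨ count-< n p ⟩
  p ⊓ n                                                         ∎
  where
  open ≡-Reasoning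
  split : ∀ a → 𝟙 (toℕ a ℕ.<? p) ≡ lowerRankEntry π p q a + rankEntry π p q a
  split a = trans (𝟙-split (toℕ a ℕ.<? p) (toℕ (π ⟨$⟩ʳ a) ℕ.<? q))
    (cong (lowerRankEntry π p q a +_) (𝟙-cong ((toℕ a ℕ.<? p) ×-dec ¬? (toℕ (π ⟨$⟩ʳ a) ℕ.<? q))
      ((toℕ a ℕ.<? p) ×-dec (q ℕ.≤? toℕ (π ⟨$⟩ʳ a)))
      (λ (a<p , πa≮q) → a<p , ≮⇒≥ πa≮q) (λ (a<p , q≤πa) → a<p , ≤⇒≯ q≤πa)))

windowEntry : ∀ {n} → Perm n → ℕ → ℕ → ℕ → Fin n → ℕ
windowEntry π p q m a = 𝟙 ((toℕ a ℕ.<? p) ×-dec (q ℕ.≤? toℕ (π ⟨$⟩ʳ a)) ×-dec (toℕ (π ⟨$⟩ʳ a) ℕ.<? m))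

window : ∀ {n} → Perm n → ℕ → ℕ → ℕ → ℕ
window π p q m = sum (windowEntry π p q m)

module _ {n} (π : Perm n) (p q m : ℕ) (a : Fin n) where

  windowEntry-yes : toℕ a < p → q ≤ toℕ (π ⟨$⟩ʳ a) → toℕ (π ⟨$⟩ʳ a) < m → windowEntry π p q m a ≡ 1
  windowEntry-yes a<p q≤πa πa<m =
    𝟙-yes ((toℕ a ℕ.<? p) ×-dec (q ℕ.≤? toℕ (π ⟨$⟩ʳ a)) ×-dec (toℕ (π ⟨$⟩ʳ a) ℕ.<? m)) (a<p , q≤πa , πa<m)

  windowEntry-no : (toℕ a < p → q ≤ toℕ (π ⟨$⟩ʳ a) → ¬ toℕ (π ⟨$⟩ʳ a) < m) → windowEntry π p q m a ≡ 0
  windowEntry-no ¬entry = 𝟙-no ((toℕ a ℕ.<? p) ×-dec (q ℕ.≤? toℕ (π ⟨$⟩ʳ a)) ×-dec (toℕ (π ⟨$⟩ʳ a) ℕ.<? m))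
    (λ (a<p , q≤πa , πa<m) → ¬entry a<p q≤πa πa<m)

rank-window : ∀ {n} (π : Perm n) p {q m} → q ≤ m → rank π p q ≡ window π p q m + rank π p m
rank-window π p {q} {m} q≤m = trans (sum-cong-≗ split) (∑-distrib-+ (windowEntry π p q m) (rankEntry π p m))
  where
  split : ∀ a → 𝟙 ((toℕ a ℕ.<? p) ×-dec (q ℕ.≤? toℕ (π ⟨$⟩ʳ a)))
              ≡ 𝟙 ((toℕ a ℕ.<? p) ×-dec (q ℕ.≤? toℕ (π ⟨$⟩ʳ a)) ×-dec (toℕ (π ⟨$⟩ʳ a) ℕ.<? m))
              + 𝟙 ((toℕ a ℕ.<? p) ×-dec (m ℕ.≤? toℕ (π ⟨$⟩ʳ a)))
  split a = trans (𝟙-split ((toℕ a ℕ.<? p) ×-dec (q ℕ.≤? toℕ (π ⟨$⟩ʳ a))) (toℕ (π ⟨$⟩ʳ a) ℕ.<? m))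
    (cong₂ _+_
      (𝟙-cong (((toℕ a ℕ.<? p) ×-dec (q ℕ.≤? toℕ (π ⟨$⟩ʳ a))) ×-dec (toℕ (π ⟨$⟩ʳ a) ℕ.<? m))
              ((toℕ a ℕ.<? p) ×-dec (q ℕ.≤? toℕ (π ⟨$⟩ʳ a)) ×-dec (toℕ (π ⟨$⟩ʳ a) ℕ.<? m))
              (λ ((a<p , q≤πa) , πa<m) → a<p , q≤πa , πa<m) (λ (a<p , q≤πa , πa<m) → (a<p , q≤πa) , πa<m))
      (𝟙-cong (((toℕ a ℕ.<? p) ×-dec (q ℕ.≤? toℕ (π ⟨$⟩ʳ a))) ×-dec ¬? (toℕ (π ⟨$⟩ʳ a) ℕ.<? m))
              ((toℕ a ℕ.<? p) ×-dec (m ℕ.≤? toℕ (π ⟨$⟩ʳ a)))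
              (λ ((a<p , _) , πa≮m) → a<p , ≮⇒≥ πa≮m) (λ (a<p , m≤πa) → (a<p , ≤-trans q≤m m≤πa) , ≤⇒≯ m≤πa)))

-- Bruhat steps raise ranks

-- Swapping the values at an ascent lo < hi of u moves the point (lo , u lo) up to
-- (lo , u hi) and (hi , u hi) down to (hi , u lo): the ranks that change are exactly
-- those in this box, each growing by one.
InSwapBox : ∀ {n} → Perm n → Fin n → Fin n → ℕ → ℕ → Set
InSwapBox u lo hi p q = toℕ lo < p × p ≤ toℕ hi × toℕ (u ⟨$⟩ʳ lo) < q × q ≤ toℕ (u ⟨$⟩ʳ hi)

inSwapBox? : ∀ {n} (u : Perm n) lo hi p q → Dec (InSwapBox u lo hi p q)
inSwapBox? u lo hi p q =
  (toℕ lo ℕ.<? p) ×-dec (p ℕ.≤? toℕ hi) ×-dec (toℕ (u ⟨$⟩ʳ lo) ℕ.<? q) ×-dec (q ℕ.≤? toℕ (u ⟨$⟩ʳ hi))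

record Swapped {n} (u v : Perm n) (i j : Fin n) : Set where
  field
    at-i      : v ⟨$⟩ʳ i ≡ u ⟨$⟩ʳ j
    at-j      : v ⟨$⟩ʳ j ≡ u ⟨$⟩ʳ i
    elsewhere : ∀ k → k ≢ i → k ≢ j → v ⟨$⟩ʳ k ≡ u ⟨$⟩ʳ k

Swapped-sym : ∀ {n} {u v : Perm n} {i j} → Swapped u v i j → Swapped v u i j
Swapped-sym sw = record
  { at-i = sym (at-j) ; at-j = sym at-i ; elsewhere = λ k k≢i k≢j → sym (elsewhere k k≢i k≢j) }
  where open Swapped sw

Swapped-flip : ∀ {n} {u v : Perm n} {i j} → Swapped u v i j → Swapped u v j i
Swapped-flip sw = record
  { at-i = at-j ; at-j = at-i ; elsewhere = λ k k≢j k≢i → elsewhere k k≢i k≢j }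
  where open Swapped sw

transpose-Swapped : ∀ {n} {u v : Perm n} (i j : Fin n) →
  (∀ k → v ⟨$⟩ʳ k ≡ u ⟨$⟩ʳ PC.transpose i j k) → Swapped u v i j
transpose-Swapped {u = u} i j v≗u∘t = record
  { at-i      = trans (v≗u∘t i) (cong (u ⟨$⟩ʳ_) transpose-i)
  ; at-j      = trans (v≗u∘t j) (cong (u ⟨$⟩ʳ_) transpose-j)
  ; elsewhere = λ k k≢i k≢j → trans (v≗u∘t k) (cong (u ⟨$⟩ʳ_) (transpose-k k k≢i k≢j))
  }
  where
  transpose-i : PC.transpose i j i ≡ j
  transpose-i with i FinP.≟ i
  ... | yes _   = refl
  ... | no i≢i  = ⊥-elim (i≢i refl)
  transpose-j : PC.transpose i j j ≡ i
  transpose-j with j FinP.≟ i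
  ... | yes j≡i = j≡i
  ... | no _ with j FinP.≟ j
  ...   | yes _  = refl
  ...   | no j≢j = ⊥-elim (j≢j refl)
  transpose-k : ∀ k → k ≢ i → k ≢ j → PC.transpose i j k ≡ k
  transpose-k k k≢i k≢j with k FinP.≟ i
  ... | yes k≡i = ⊥-elim (k≢i k≡i)
  ... | no _ with k FinP.≟ j
  ...   | yes k≡j = ⊥-elim (k≢j k≡j)
  ...   | no _    = refl

module _ {n} {u v : Perm n} {lo hi : Fin n} (sw : Swapped u v lo hi)
         (lo<hi : lo F.< hi) (ulo<uhi : u ⟨$⟩ʳ lo F.< u ⟨$⟩ʳ hi) where
  open Swapped sw

  private
    lo≢hi : lo ≢ hi
    lo≢hi lo≡hi = <-irrefl (cong toℕ lo≡hi) lo<hi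

  rank-swap : ∀ p q → rank v p q ≡ rank u p q + 𝟙 (inSwapBox? u lo hi p q)
  rank-swap p q = begin
    rank v p q                          ≡⟨ +-identityʳ _ ⟨
    rank v p q + 0                      ≡⟨ sum-≡-except₂ lo≢hi at-lo-hi (λ a a≢lo a≢hi → rankEntry-cong v u p q (elsewhere a a≢lo a≢hi)) ⟩
    rank u p q + 𝟙 (inSwapBox? u lo hi p q)    ∎
    where
    open ≡-Reasoning
    at-lo-hi : rankEntry v p q lo + rankEntry v p q hi + 0 ≡ rankEntry u p q lo + rankEntry u p q hi + 𝟙 (inSwapBox? u lo hi p q)
    at-lo-hi = begin
      rankEntry v p q lo + rankEntry v p q hi + 0
        ≡⟨ +-identityʳ _ ⟩
      rankEntry v p q lo + rankEntry v p q hi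
        ≡⟨ cong₂ _+_ (rankEntry-cong v u p q at-i) (rankEntry-cong v u p q at-j) ⟩
      _ ≡⟨ 𝟙-exchange (toℕ lo ℕ.<? p) (toℕ hi ℕ.<? p) (q ℕ.≤? toℕ (u ⟨$⟩ʳ lo)) (q ℕ.≤? toℕ (u ⟨$⟩ʳ hi))
                      (<-trans lo<hi) (λ q≤ulo → ≤-trans q≤ulo (<⇒≤ ulo<uhi)) ⟩
      rankEntry u p q lo + rankEntry u p q hi + _
        ≡⟨ cong (rankEntry u p q lo + rankEntry u p q hi +_)
                (𝟙-cong ((toℕ lo ℕ.<? p) ×-dec ¬? (toℕ hi ℕ.<? p) ×-dec ¬? (q ℕ.≤? toℕ (u ⟨$⟩ʳ lo))
                           ×-dec (q ℕ.≤? toℕ (u ⟨$⟩ʳ hi)))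
                        (inSwapBox? u lo hi p q)
                        (λ (lo<p , hi≮p , q≰ulo , q≤uhi) → lo<p , ≮⇒≥ hi≮p , ≰⇒> q≰ulo , q≤uhi)
                        (λ (lo<p , p≤hi , ulo<q , q≤uhi) → lo<p , ≤⇒≯ p≤hi , <⇒≱ ulo<q , q≤uhi)) ⟩
      rankEntry u p q lo + rankEntry u p q hi + 𝟙 (inSwapBox? u lo hi p q) ∎

  private
    inversion : Perm n → Fin n → Fin n → ℕ
    inversion π a b = 𝟙 ((a FinP.<? b) ×-dec (π ⟨$⟩ʳ b FinP.<? π ⟨$⟩ʳ a))

    inversionsFrom : Perm n → Fin n → ℕ
    inversionsFrom π a = sum (inversion π a)

    inversionsFrom-lo-hi : inversionsFrom u lo + inversionsFrom u hi + 1 ≤ inversionsFrom v lo + inversionsFrom v hi + 0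
    inversionsFrom-lo-hi = subst₂ (λ x y → x + 1 ≤ y + 0)
      (∑-distrib-+ (inversion u lo) (inversion u hi)) (∑-distrib-+ (inversion v lo) (inversion v hi))
      (sum-≤-except₁ hi at-hi elsewhere-hi)
      where
      at-hi : inversion u lo hi + inversion u hi hi + 1 ≤ inversion v lo hi + inversion v hi hi + 0
      at-hi
        rewrite 𝟙-no ((lo FinP.<? hi) ×-dec (u ⟨$⟩ʳ hi FinP.<? u ⟨$⟩ʳ lo)) (λ (_ , uhi<ulo) → <-asym uhi<ulo ulo<uhi)
              | 𝟙-no ((hi FinP.<? hi) ×-dec (u ⟨$⟩ʳ hi FinP.<? u ⟨$⟩ʳ hi)) (λ (hi<hi , _) → <-irrefl refl hi<hi)
              | 𝟙-no ((hi FinP.<? hi) ×-dec (v ⟨$⟩ʳ hi FinP.<? v ⟨$⟩ʳ hi)) (λ (hi<hi , _) → <-irrefl refl hi<hi)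
              | 𝟙-yes ((lo FinP.<? hi) ×-dec (v ⟨$⟩ʳ hi FinP.<? v ⟨$⟩ʳ lo))
                       (lo<hi , subst₂ F._<_ (sym at-j) (sym at-i) ulo<uhi)
              = ≤-refl
      elsewhere-hi : ∀ b → b ≢ hi → inversion u lo b + inversion u hi b ≤ inversion v lo b + inversion v hi b
      elsewhere-hi b b≢hi with b FinP.≟ lo
      ... | yes refl
        rewrite 𝟙-no ((b FinP.<? b) ×-dec (u ⟨$⟩ʳ b FinP.<? u ⟨$⟩ʳ b)) (λ (b<b , _) → <-irrefl refl b<b)
              | 𝟙-no ((hi FinP.<? b) ×-dec (u ⟨$⟩ʳ b FinP.<? u ⟨$⟩ʳ hi)) (λ (hi<b , _) → <-asym hi<b lo<hi)
              = z≤n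
      ... | no b≢lo = subst (inversion u lo b + inversion u hi b ≤_) (sym v-entries)
              (𝟙-exchange-≤ (lo FinP.<? b) (hi FinP.<? b) (u ⟨$⟩ʳ b FinP.<? u ⟨$⟩ʳ lo) (u ⟨$⟩ʳ b FinP.<? u ⟨$⟩ʳ hi)
                            (<-trans lo<hi) (λ ub<ulo → <-trans ub<ulo ulo<uhi))
        where
        v-entries : inversion v lo b + inversion v hi b
                  ≡ 𝟙 ((lo FinP.<? b) ×-dec (u ⟨$⟩ʳ b FinP.<? u ⟨$⟩ʳ hi)) + 𝟙 ((hi FinP.<? b) ×-dec (u ⟨$⟩ʳ b FinP.<? u ⟨$⟩ʳ lo))
        v-entries = cong₂ _+_
          (cong₂ (λ y z → 𝟙 ((lo FinP.<? b) ×-dec (y FinP.<? z))) (elsewhere b b≢lo b≢hi) at-i)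
          (cong₂ (λ y z → 𝟙 ((hi FinP.<? b) ×-dec (y FinP.<? z))) (elsewhere b b≢lo b≢hi) at-j)

    inversionsFrom-other : ∀ x → x ≢ lo → x ≢ hi → inversionsFrom u x ≤ inversionsFrom v x
    inversionsFrom-other x x≢lo x≢hi = subst₂ _≤_ (+-identityʳ _) (+-identityʳ _)
      (sum-≤-except₂ lo≢hi at-lo-hi elsewhere-lo-hi)
      where
      vx≡ux : v ⟨$⟩ʳ x ≡ u ⟨$⟩ʳ x
      vx≡ux = elsewhere x x≢lo x≢hi
      v-entries : inversion v x hi + inversion v x lo
                ≡ 𝟙 ((x FinP.<? hi) ×-dec (u ⟨$⟩ʳ lo FinP.<? u ⟨$⟩ʳ x)) + 𝟙 ((x FinP.<? lo) ×-dec (u ⟨$⟩ʳ hi FinP.<? u ⟨$⟩ʳ x))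
      v-entries = cong₂ _+_
        (cong₂ (λ y z → 𝟙 ((x FinP.<? hi) ×-dec (y FinP.<? z))) at-j vx≡ux)
        (cong₂ (λ y z → 𝟙 ((x FinP.<? lo) ×-dec (y FinP.<? z))) at-i vx≡ux)
      at-lo-hi : inversion u x lo + inversion u x hi + 0 ≤ inversion v x lo + inversion v x hi + 0
      at-lo-hi = begin
        inversion u x lo + inversion u x hi + 0   ≡⟨ +-identityʳ _ ⟩
        inversion u x lo + inversion u x hi       ≡⟨ +-comm (inversion u x lo) _ ⟩
        inversion u x hi + inversion u x lo
          ≤⟨ 𝟙-exchange-≤ (x FinP.<? hi) (x FinP.<? lo) (u ⟨$⟩ʳ hi FinP.<? u ⟨$⟩ʳ x) (u ⟨$⟩ʳ lo FinP.<? u ⟨$⟩ʳ x)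
                          (λ x<lo → <-trans x<lo lo<hi) (<-trans ulo<uhi) ⟩
        _                                         ≡⟨ v-entries ⟨
        inversion v x hi + inversion v x lo       ≡⟨ +-comm (inversion v x hi) _ ⟩
        inversion v x lo + inversion v x hi       ≡⟨ +-identityʳ _ ⟨
        inversion v x lo + inversion v x hi + 0   ∎
        where open ≤-Reasoning
      elsewhere-lo-hi : ∀ b → b ≢ lo → b ≢ hi → inversion u x b ≤ inversion v x b
      elsewhere-lo-hi b b≢lo b≢hi = ≤-reflexive
        (cong₂ (λ y z → 𝟙 ((x FinP.<? b) ×-dec (y FinP.<? z))) (sym (elsewhere b b≢lo b≢hi)) (sym vx≡ux))

  inversions-swap : inversions u < inversions v
  inversions-swap = subst₂ _≤_ (trans (+-comm _ 1) (cong suc (sym (inversions≡sum u))))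
                               (trans (+-identityʳ _) (sym (inversions≡sum v)))
    (sum-≤-except₂ lo≢hi inversionsFrom-lo-hi inversionsFrom-other)
    where
    inversions≡sum : ∀ π → inversions π ≡ sum (inversionsFrom π)
    inversions≡sum π = countPairs≡sum (λ p → (proj₁ p FinP.<? proj₂ p) ×-dec (π ⟨$⟩ʳ proj₂ p FinP.<? π ⟨$⟩ʳ proj₁ p))

Swapped-ascent : ∀ {n} {u v : Perm n} {lo hi} → Swapped u v lo hi → lo F.< hi →
  inversions u < inversions v → u ⟨$⟩ʳ lo F.< u ⟨$⟩ʳ hi
Swapped-ascent {u = u} {v} {lo} {hi} sw lo<hi inv-u<inv-v with FinP.<-cmp (u ⟨$⟩ʳ lo) (u ⟨$⟩ʳ hi)
... | tri< ulo<uhi _ _ = ulo<uhi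
... | tri≈ _ ulo≡uhi _ = ⊥-elim (<-irrefl (cong toℕ (Perm-injective u ulo≡uhi)) lo<hi)
... | tri> _ _ uhi<ulo = ⊥-elim (<-asym inv-u<inv-v (inversions-swap (Swapped-sym sw) lo<hi
        (subst₂ F._<_ (sym (Swapped.at-i sw)) (sym (Swapped.at-j sw)) uhi<ulo)))

Swapped-≤ʳ : ∀ {n} {u v : Perm n} {lo hi} → Swapped u v lo hi → lo F.< hi →
  inversions u < inversions v → u ≤ʳ v
Swapped-≤ʳ sw lo<hi inv-u<inv-v p q = ≤-trans (m≤m+n _ _)
  (≤-reflexive (sym (rank-swap sw lo<hi (Swapped-ascent sw lo<hi inv-u<inv-v) p q)))

BruhatStep⇒≤ʳ : ∀ {n} {u v : Perm n} → BruhatStep u v → u ≤ʳ v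
BruhatStep⇒≤ʳ {u = u} {v} (i , j , i≢j , v≗u∘t , inv-u<inv-v) with FinP.<-cmp i j
... | tri< i<j _ _ = Swapped-≤ʳ (transpose-Swapped {u = u} {v} i j v≗u∘t) i<j inv-u<inv-v
... | tri≈ _ i≡j _ = ⊥-elim (i≢j i≡j)
... | tri> _ _ j<i = Swapped-≤ʳ (Swapped-flip (transpose-Swapped {u = u} {v} i j v≗u∘t)) j<i inv-u<inv-v

≤B⇒≤ʳ : ∀ {n} {u w : Perm n} → u ≤B w → u ≤ʳ w
≤B⇒≤ʳ (≤B-refl {u} {w} u≈w)         p q = ≤-reflexive (rank-cong {π = u} {w} u≈w p q)
≤B⇒≤ʳ (≤B-step {u} {v} u⋖v v≤w)     p q = ≤-trans (BruhatStep⇒≤ʳ {u = u} {v} u⋖v p q) (≤B⇒≤ʳ v≤w p q)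

-- Dominated ranks imply the Bruhat order

rankRow : ∀ {n} → Perm n → Fin (suc n) → ℕ
rankRow {n} π p = sum (λ (q : Fin (suc n)) → rank π (toℕ p) (toℕ q))

totalRank : ∀ {n} → Perm n → ℕ
totalRank π = sum (rankRow π)

rankRow-mono : ∀ {n} {u v : Perm n} → u ≤ʳ v → ∀ p → rankRow u p ≤ rankRow v p
rankRow-mono {n} {u} {v} u≤v p = sum-mono {suc n} {λ q → rank u (toℕ p) (toℕ q)} (λ q → u≤v (toℕ p) (toℕ q))

totalRank-mono : ∀ {n} {u v : Perm n} → u ≤ʳ v → totalRank u ≤ totalRank v
totalRank-mono {n} {u} {v} u≤v = sum-mono {suc n} {rankRow u} {rankRow v} (rankRow-mono {u = u} {v} u≤v)

totalRank-< : ∀ {n} {u v : Perm n} → u ≤ʳ v → ∀ {p q} → p ≤ n → q ≤ n → rank u p q < rank v p q →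
  totalRank u < totalRank v
totalRank-< {n} {u} {v} u≤v {p} {q} p≤n q≤n u<v =
  sum-< p′ {rankRow u} {rankRow v} (rankRow-mono {u = u} {v} u≤v)
    (sum-< {suc n} q′ {λ q → rank u (toℕ p′) (toℕ q)} {λ q → rank v (toℕ p′) (toℕ q)} (λ q → u≤v (toℕ p′) (toℕ q))
      (subst₂ (λ x y → rank u x y < rank v x y) (sym (FinP.toℕ-fromℕ< (s≤s p≤n))) (sym (FinP.toℕ-fromℕ< (s≤s q≤n))) u<v))
  where
  p′ q′ : Fin (suc n)
  p′ = F.fromℕ< (s≤s p≤n)
  q′ = F.fromℕ< (s≤s q≤n)

module _ {n} {u w : Perm n} (u≤w : u ≤ʳ w) {i : Fin n} (ui≢wi : u ⟨$⟩ʳ i ≢ w ⟨$⟩ʳ i)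
         (agree : ∀ a → a F.< i → u ⟨$⟩ʳ a ≡ w ⟨$⟩ʳ a) where

  ui<wi : u ⟨$⟩ʳ i F.< w ⟨$⟩ʳ i
  ui<wi with FinP.<-cmp (u ⟨$⟩ʳ i) (w ⟨$⟩ʳ i)
  ... | tri< ui<wi _ _ = ui<wi
  ... | tri≈ _ ui≡wi _ = ⊥-elim (ui≢wi ui≡wi)
  ... | tri> _ _ wi<ui = ⊥-elim (<⇒≱ (sum-< i w≤u-entry w<u-at-i) (u≤w (suc (toℕ i)) (toℕ (u ⟨$⟩ʳ i))))
    where
    w≤u-entry : ∀ a → rankEntry w (suc (toℕ i)) (toℕ (u ⟨$⟩ʳ i)) a ≤ rankEntry u (suc (toℕ i)) (toℕ (u ⟨$⟩ʳ i)) a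
    w≤u-entry a = rankEntry-mono w _ _ a u _ λ where
      (s≤s a≤i) ui≤wa → [ (λ a<i → subst (λ z → toℕ (u ⟨$⟩ʳ i) ≤ toℕ z) (sym (agree a a<i)) ui≤wa)
                        , (λ { refl → ⊥-elim (<⇒≱ wi<ui ui≤wa) }) ]′ (Fin-≤⇒<⊎≡ a≤i)
    w<u-at-i : rankEntry w (suc (toℕ i)) (toℕ (u ⟨$⟩ʳ i)) i < rankEntry u (suc (toℕ i)) (toℕ (u ⟨$⟩ʳ i)) i
    w<u-at-i = subst₂ _<_ (sym (rankEntry-no w _ _ i (λ _ → <⇒≱ wi<ui))) (sym (rankEntry-yes u _ _ i ≤-refl ≤-refl)) ℕ.z<s

  private
    W : ℕ
    W = toℕ (w ⟨$⟩ʳ i)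

    Between : Pred (Fin n) 0ℓ
    Between a = i F.< a × u ⟨$⟩ʳ i F.< u ⟨$⟩ʳ a × toℕ (u ⟨$⟩ʳ a) ≤ W

    between? : Decidable Between
    between? a = (i FinP.<? a) ×-dec (u ⟨$⟩ʳ i FinP.<? u ⟨$⟩ʳ a) ×-dec (toℕ (u ⟨$⟩ʳ a) ℕ.≤? W)

    j₀ : Fin n
    j₀ = u ⟨$⟩ˡ (w ⟨$⟩ʳ i)

    uj₀≡wi : u ⟨$⟩ʳ j₀ ≡ w ⟨$⟩ʳ i
    uj₀≡wi = inverseʳ u

    between-j₀ : Between j₀
    between-j₀ = i<j₀ , subst (u ⟨$⟩ʳ i F.<_) (sym uj₀≡wi) ui<wi , ≤-reflexive (cong toℕ uj₀≡wi)
      where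
      i<j₀ : i F.< j₀
      i<j₀ with FinP.<-cmp i j₀
      ... | tri< i<j₀ _ _ = i<j₀
      ... | tri≈ _ i≡j₀ _ = ⊥-elim (ui≢wi (trans (cong (u ⟨$⟩ʳ_) i≡j₀) uj₀≡wi))
      ... | tri> _ _ j₀<i = ⊥-elim (<-irrefl (cong toℕ (Perm-injective w (trans (sym (agree j₀ j₀<i)) uj₀≡wi))) j₀<i)

  private
    j : Fin n
    j = proj₁ (least-witness between? between-j₀)

    between-j : Between j
    between-j = proj₁ (proj₂ (least-witness between? between-j₀))

    least-j : ∀ a → a F.< j → ¬ Between a
    least-j = proj₂ (proj₂ (least-witness between? between-j₀))

    i<j : i F.< j
    i<j = proj₁ between-j

    ui<uj : u ⟨$⟩ʳ i F.< u ⟨$⟩ʳ j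
    ui<uj = proj₁ (proj₂ between-j)

  -- Inside the swap box the rank of u is strictly below that of w: the points of u and w
  -- in rows < p with values in [q , w i] differ only in that w has one at row i.
  rank-<-in-box : ∀ p q → InSwapBox u i j p q → rank u p q < rank w p q
  rank-<-in-box p q (i<p , p≤j , ui<q , q≤uj) = begin-strict
    rank u p q                             ≡⟨ rank-window u p q≤m ⟩
    window u p q m + rank u p m            ≤⟨ +-monoʳ-≤ (window u p q m) (u≤w p m) ⟩
    window u p q m + rank w p m            <⟨ +-monoˡ-< (rank w p m) window-< ⟩
    window w p q m + rank w p m            ≡⟨ rank-window w p q≤m ⟨
    rank w p q                             ∎
    where
    open ≤-Reasoning
    m : ℕ
    m = suc W
    q≤m : q ≤ m
    q≤m = ≤-trans q≤uj (m≤n⇒m≤1+n (proj₂ (proj₂ between-j)))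
    u-entry≡0 : ∀ a → ¬ a F.< i → windowEntry u p q m a ≡ 0
    u-entry≡0 a a≮i = windowEntry-no u p q m a λ a<p q≤ua ua<m →
      [ (λ i<a → least-j a (<-≤-trans a<p p≤j) (i<a , <-≤-trans ui<q q≤ua , ℕ.s≤s⁻¹ ua<m))
      , (λ { refl → <⇒≱ ui<q q≤ua }) ]′ (Fin-≤⇒<⊎≡ (≮⇒≥ a≮i))
    entry-≤ : ∀ a → windowEntry u p q m a ≤ windowEntry w p q m a
    entry-≤ a with a FinP.<? i
    ... | yes a<i = ≤-reflexive (cong (λ z → 𝟙 ((toℕ a ℕ.<? p) ×-dec (q ℕ.≤? toℕ z) ×-dec (toℕ z ℕ.<? m))) (agree a a<i))
    ... | no a≮i  = ≤-trans (≤-reflexive (u-entry≡0 a a≮i)) z≤n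
    window-< : window u p q m < window w p q m
    window-< = sum-< i entry-≤ (subst₂ _<_ (sym (u-entry≡0 i (<-irrefl refl)))
      (sym (windowEntry-yes w p q m i i<p (≤-trans q≤uj (proj₂ (proj₂ between-j))) ≤-refl)) ℕ.z<s)

  step-toward : Σ (Perm n) λ v → BruhatStep u v × v ≤ʳ w × totalRank u < totalRank v
  step-toward = v , (i , j , i≢j , (λ _ → refl) , inversions-swap sw i<j ui<uj) , v≤w , totalRank-u<v
    where
    v : Perm n
    v = Pm.transpose i j ∘ₚ u
    sw : Swapped u v i j
    sw = transpose-Swapped i j (λ _ → refl)
    i≢j : i ≢ j
    i≢j i≡j = <-irrefl (cong toℕ i≡j) i<j
    rank-v : ∀ p q → rank v p q ≡ rank u p q + 𝟙 (inSwapBox? u i j p q)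
    rank-v = rank-swap sw i<j ui<uj
    v≤w : v ≤ʳ w
    v≤w p q = subst (_≤ rank w p q) (sym (rank-v p q)) (bound (inSwapBox? u i j p q))
      where
      bound : (box? : Dec (InSwapBox u i j p q)) → rank u p q + 𝟙 box? ≤ rank w p q
      bound (yes box) = subst (_≤ rank w p q) (+-comm 1 _) (rank-<-in-box p q box)
      bound (no _)    = subst (_≤ rank w p q) (sym (+-identityʳ _)) (u≤w p q)
    totalRank-u<v : totalRank u < totalRank v
    totalRank-u<v = totalRank-< {u = u} {v} (λ p q → subst (rank u p q ≤_) (sym (rank-v p q)) (m≤m+n _ _))
      (<⇒≤ (FinP.toℕ<n j)) (<⇒≤ (FinP.toℕ<n (u ⟨$⟩ʳ j)))
      grows-at-corner
      where
      p q : ℕ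
      p = toℕ j
      q = toℕ (u ⟨$⟩ʳ j)
      grows-at-corner : rank u p q < rank v p q
      grows-at-corner = ≤-reflexive (sym (begin
        rank v p q                              ≡⟨ rank-v p q ⟩
        rank u p q + 𝟙 (inSwapBox? u i j p q)   ≡⟨ cong (rank u p q +_) (𝟙-yes (inSwapBox? u i j p q) (i<j , ≤-refl , ui<uj , ≤-refl)) ⟩
        rank u p q + 1                          ≡⟨ +-comm _ 1 ⟩
        suc (rank u p q)                        ∎))
        where open ≡-Reasoning

-- Climb from u towards w by Bruhat steps: the total rank grows strictly and stays bounded
-- by that of w.
≤ʳ⇒≤B : ∀ {n} {u w : Perm n} → u ≤ʳ w → u ≤B w
≤ʳ⇒≤B {n} {u} {w} = climb (totalRank w) u (m≤n+m (totalRank w) (totalRank u))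
  where
  budget-exhausted : ∀ {x y z : ℕ} → z ≤ x + 0 → x < y → ¬ y ≤ z
  budget-exhausted {x} z≤x+0 x<y y≤z = <⇒≱ (<-≤-trans x<y y≤z) (subst (_ ≤_) (+-identityʳ x) z≤x+0)
  budget-spent : ∀ {x y z : ℕ} k → z ≤ x + suc k → x < y → z ≤ y + k
  budget-spent {x} k z≤x+1+k x<y = ≤-trans z≤x+1+k (≤-trans (≤-reflexive (+-suc x k)) (+-monoˡ-≤ k x<y))
  Step : Perm n → Set
  Step u = Σ (Perm n) λ v → BruhatStep u v × v ≤ʳ w × totalRank u < totalRank v
  climb : ∀ k (u : Perm n) → totalRank w ≤ totalRank u + k → u ≤ʳ w → u ≤B w
  climb-by : ∀ k (u : Perm n) → totalRank w ≤ totalRank u + k → Step u → u ≤B w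
  climb k u budget u≤w = [ ≤B-refl {u = u} {w} , (λ (_ , ui≢wi , agree) → climb-by k u budget (step-toward {u = u} {w} u≤w ui≢wi agree)) ]′
    (first-difference u w)
  climb-by zero    u budget (v , _ , v≤w , u<v) = ⊥-elim (budget-exhausted budget u<v (totalRank-mono {u = v} {w} v≤w))
  climb-by (suc k) u budget (v , u⋖v , v≤w , u<v) = ≤B-step u⋖v (climb k v (budget-spent k budget u<v) v≤w)

-- Involutions

module _ {n} {γ : Perm n} (γ-involutive : IsInvolution γ) where

  sum-involution : ∀ (F : ℕ → ℕ → ℕ) →
    sum (λ a → F (toℕ (γ ⟨$⟩ʳ a)) (toℕ a)) ≡ sum (λ a → F (toℕ a) (toℕ (γ ⟨$⟩ʳ a)))
  sum-involution F = trans (sum-permute (λ a → F (toℕ (γ ⟨$⟩ʳ a)) (toℕ a)) γ)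
    (sum-cong-≗ (λ a → cong (λ z → F (toℕ z) (toℕ (γ ⟨$⟩ʳ a))) (γ-involutive a)))

  lowerRank-involution : ∀ p q → lowerRank γ p q ≡ lowerRank γ q p
  lowerRank-involution p q = trans
    (sym (sum-involution (λ x y → 𝟙 ((x ℕ.<? p) ×-dec (y ℕ.<? q)))))
    (sum-cong-≗ (λ a → 𝟙-cong ((toℕ (γ ⟨$⟩ʳ a) ℕ.<? p) ×-dec (toℕ a ℕ.<? q))
                              ((toℕ a ℕ.<? q) ×-dec (toℕ (γ ⟨$⟩ʳ a) ℕ.<? p)) swap swap))

  rank-involution : ∀ p q → rank γ p q + q ⊓ n ≡ p ⊓ n + rank γ q p
  rank-involution p q = begin
    rank γ p q + q ⊓ n                              ≡⟨ cong (rank γ p q +_) (lowerRank+rank γ q p) ⟨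
    rank γ p q + (lowerRank γ q p + rank γ q p)     ≡⟨ cong (λ z → rank γ p q + (z + rank γ q p)) (lowerRank-involution q p) ⟩
    rank γ p q + (lowerRank γ p q + rank γ q p)     ≡⟨ +-assoc (rank γ p q) _ _ ⟨
    rank γ p q + lowerRank γ p q + rank γ q p       ≡⟨ cong (_+ rank γ q p) (trans (+-comm (rank γ p q) _) (lowerRank+rank γ p q)) ⟩
    p ⊓ n + rank γ q p                              ∎
    where open ≡-Reasoning

pairCount≡rank : ∀ {n} (π : Perm n) {s t} → s < t → pairCount π s t ≡ rank π s t
pairCount≡rank π {s} {t} s<t = trans (countPairs-graph π pair? (proj₂ ∘ proj₂ ∘ proj₂))
  (sum-cong-≗ λ a → 𝟙-cong (pair? (a , π ⟨$⟩ʳ a)) ((toℕ a ℕ.<? s) ×-dec (t ℕ.≤? toℕ (π ⟨$⟩ʳ a)))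
    (λ (_ , a<s , t<1+πa , _) → a<s , ℕ.s≤s⁻¹ t<1+πa)
    (λ (a<s , t≤πa) → <-≤-trans (<-trans a<s s<t) t≤πa , a<s , s≤s t≤πa , refl))
  where
  pair? : ∀ p → Dec (proj₁ p F.< proj₂ p × toℕ (proj₁ p) < s × t < suc (toℕ (proj₂ p)) × π ⟨$⟩ʳ proj₁ p ≡ proj₂ p)
  pair? p = (proj₁ p FinP.<? proj₂ p) ×-dec ((toℕ (proj₁ p) ℕ.<? s)
            ×-dec ((t ℕ.<? suc (toℕ (proj₂ p))) ×-dec (π ⟨$⟩ʳ proj₁ p FinP.≟ proj₂ p)))

-- γ(i;·) counts the points (a , γ a) of γ in the square [0 , i) × [0 , i): a fixed point
-- gives one, a 2-cycle gives two, (a , γ a) and (γ a , a).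
dotCount≡lowerRank : ∀ {n} {γ : Perm n} → IsInvolution γ → ∀ i → dotCount γ i ≡ lowerRank γ i i
dotCount≡lowerRank {n} {γ} γ-involutive i = begin
  dotCount γ i                                     ≡⟨ cong₂ (λ x y → x + 2 * y) (countFin≡sum (λ a → (toℕ a ℕ.<? i) ×-dec (γ ⟨$⟩ʳ a FinP.≟ a))) twoCycles≡ascents ⟩
  sum fixed + 2 * sum ascent                       ≡⟨ double (sum fixed) (sum ascent) ⟩
  sum fixed + sum ascent + sum ascent              ≡⟨ cong (sum fixed + sum ascent +_) (sym (sum-involution {γ = γ} γ-involutive (λ x y → 𝟙 ((x ℕ.<? y) ×-dec (y ℕ.<? i))))) ⟩
  sum fixed + sum ascent + sum descent             ≡⟨ cong (_+ sum descent) (∑-distrib-+ fixed ascent) ⟨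
  sum (λ a → fixed a + ascent a) + sum descent     ≡⟨ ∑-distrib-+ (λ a → fixed a + ascent a) descent ⟨
  sum (λ a → fixed a + ascent a + descent a)       ≡⟨ sum-cong-≗ (λ a → 𝟙-trichotomy a (γ ⟨$⟩ʳ a) i) ⟨
  lowerRank γ i i                                  ∎
  where
  open ≡-Reasoning
  fixed ascent descent : Fin n → ℕ
  fixed a   = 𝟙 ((toℕ a ℕ.<? i) ×-dec (γ ⟨$⟩ʳ a FinP.≟ a))
  ascent a  = 𝟙 ((toℕ a ℕ.<? toℕ (γ ⟨$⟩ʳ a)) ×-dec (toℕ (γ ⟨$⟩ʳ a) ℕ.<? i))
  descent a = 𝟙 ((toℕ (γ ⟨$⟩ʳ a) ℕ.<? toℕ a) ×-dec (toℕ a ℕ.<? i))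
  twoCycles≡ascents : countPairs (λ p → (proj₁ p FinP.<? proj₂ p) ×-dec (toℕ (proj₂ p) ℕ.<? i)
                                  ×-dec (γ ⟨$⟩ʳ proj₁ p FinP.≟ proj₂ p))
              ≡ sum ascent
  twoCycles≡ascents = trans (countPairs-graph γ (λ p → (proj₁ p FinP.<? proj₂ p) ×-dec (toℕ (proj₂ p) ℕ.<? i) ×-dec (γ ⟨$⟩ʳ proj₁ p FinP.≟ proj₂ p)) (proj₂ ∘ proj₂))
    (sum-cong-≗ λ a → 𝟙-cong ((a FinP.<? γ ⟨$⟩ʳ a) ×-dec (toℕ (γ ⟨$⟩ʳ a) ℕ.<? i) ×-dec (γ ⟨$⟩ʳ a FinP.≟ γ ⟨$⟩ʳ a))
                             ((toℕ a ℕ.<? toℕ (γ ⟨$⟩ʳ a)) ×-dec (toℕ (γ ⟨$⟩ʳ a) ℕ.<? i))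
                             (λ (a<γa , γa<i , _) → a<γa , γa<i)
                                                          (λ (a<γa , γa<i) → a<γa , γa<i , refl))
  double : ∀ x y → x + 2 * y ≡ x + y + y
  double = solve-∀

module _ {n} {γ τ : Perm n} (γ-involutive : IsInvolution γ) (τ-involutive : IsInvolution τ) where

  private
    complementˡ-≤ : ∀ {x y x′ y′ k : ℕ} → x + y ≡ k → x′ + y′ ≡ k → y ≤ y′ → x′ ≤ x
    complementˡ-≤ {x} {y} {x′} {y′} x+y≡k x′+y′≡k y≤y′ =
      +-cancelʳ-≤ y′ x′ x (≤-trans (≤-reflexive (trans x′+y′≡k (sym x+y≡k))) (+-monoʳ-≤ x y≤y′))

    complementʳ-≤ : ∀ {x y x′ y′ k : ℕ} → x + y ≡ k → x′ + y′ ≡ k → x ≤ x′ → y′ ≤ y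
    complementʳ-≤ {x} {y} {x′} {y′} x+y≡k x′+y′≡k x≤x′ =
      complementˡ-≤ (trans (+-comm y x) x+y≡k) (trans (+-comm y′ x′) x′+y′≡k) x≤x′

    diagonal-≤ : ∀ i → dotCount τ i ≤ dotCount γ i → rank γ i i ≤ rank τ i i
    diagonal-≤ i τ≤γ = complementʳ-≤ (lowerRank+rank τ i i) (lowerRank+rank γ i i)
      (subst₂ _≤_ (dotCount≡lowerRank {γ = τ} τ-involutive i) (dotCount≡lowerRank {γ = γ} γ-involutive i) τ≤γ)

    above : (∀ s t → 1 ≤ s → s < t → t ≤ n → pairCount γ s t ≤ pairCount τ s t) →
      ∀ {p q} → p < q → rank γ p q ≤ rank τ p q
    above _ {zero} {q} _ = ≤-reflexive (trans (rank-zeroˡ γ q) (sym (rank-zeroˡ τ q)))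
    above pairs {suc p} {q} p<q with n ℕ.≤? q
    ... | yes n≤q = ≤-reflexive (trans (rank-≥ γ (suc p) n≤q) (sym (rank-≥ τ (suc p) n≤q)))
    ... | no n≰q  = subst₂ _≤_ (pairCount≡rank γ p<q) (pairCount≡rank τ p<q)
                      (pairs (suc p) q (s≤s z≤n) p<q (<⇒≤ (≰⇒> n≰q)))
    on-diagonal : (∀ i → 1 ≤ i → i ≤ n → dotCount γ i ≥ dotCount τ i) → ∀ p → rank γ p p ≤ rank τ p p
    on-diagonal _ zero = ≤-reflexive (trans (rank-zeroˡ γ 0) (sym (rank-zeroˡ τ 0)))
    on-diagonal dots (suc p) with n ℕ.≤? suc p
    ... | yes n≤p = ≤-reflexive (trans (rank-≥ γ (suc p) n≤p) (sym (rank-≥ τ (suc p) n≤p)))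
    ... | no n≰p  = diagonal-≤ (suc p) (dots (suc p) (s≤s z≤n) (<⇒≤ (≰⇒> n≰p)))

  ≤ʳ⇒conditions : γ ≤ʳ τ →
    (∀ i → 1 ≤ i → i ≤ n → dotCount γ i ≥ dotCount τ i)
      × (∀ s t → 1 ≤ s → s < t → t ≤ n → pairCount γ s t ≤ pairCount τ s t)
  ≤ʳ⇒conditions γ≤τ =
      (λ i _ _ → subst₂ _≤_ (sym (dotCount≡lowerRank {γ = τ} τ-involutive i)) (sym (dotCount≡lowerRank {γ = γ} γ-involutive i))
                   (complementˡ-≤ (lowerRank+rank γ i i) (lowerRank+rank τ i i) (γ≤τ i i)))
    , (λ s t _ s<t _ → subst₂ _≤_ (sym (pairCount≡rank γ s<t)) (sym (pairCount≡rank τ s<t)) (γ≤τ s t))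

  conditions⇒≤ʳ :
    (∀ i → 1 ≤ i → i ≤ n → dotCount γ i ≥ dotCount τ i)
      × (∀ s t → 1 ≤ s → s < t → t ≤ n → pairCount γ s t ≤ pairCount τ s t)
    → γ ≤ʳ τ
  conditions⇒≤ʳ (dots , pairs) p q with <-cmp p q
  ... | tri< p<q _ _ = above pairs p<q
  ... | tri≈ _ refl _ = on-diagonal dots p
  ... | tri> _ _ q<p = +-cancelʳ-≤ (q ⊓ n) (rank γ p q) (rank τ p q) (begin
    rank γ p q + q ⊓ n      ≡⟨ rank-involution {γ = γ} γ-involutive p q ⟩
    p ⊓ n + rank γ q p      ≤⟨ +-monoʳ-≤ (p ⊓ n) (above pairs q<p) ⟩
    p ⊓ n + rank τ q p      ≡⟨ rank-involution {γ = τ} τ-involutive p q ⟨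
    rank τ p q + q ⊓ n      ∎)
    where open ≤-Reasoning

proposition2p5 : ∀ {n} (γ τ : Perm n) → IsInvolution γ → IsInvolution τ →
    (γ ≤B τ)
      ⇔ ((∀ i → 1 ≤ i → i ≤ n → dotCount γ i ≥ dotCount τ i)
          × (∀ s t → 1 ≤ s → s < t → t ≤ n → pairCount γ s t ≤ pairCount τ s t))
proposition2p5 γ τ γ-involutive τ-involutive = mk⇔
  (≤ʳ⇒conditions {γ = γ} {τ} γ-involutive τ-involutive ∘ ≤B⇒≤ʳ)
  (≤ʳ⇒≤B {u = γ} {τ} ∘ conditions⇒≤ʳ {γ = γ} {τ} γ-involutive τ-involutive)
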